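{- Assume Hypothesis H (described in the context) holds, and let $b$ and $r$ denote the number of blocks and the number of blocks through a point, so $b=vr/k$. Suppose that $p$ is a prime such that (i) $0\leq d-p<\frac{k}{\ell}<p$, and (ii) $p$ does not divide $b$. Then $p$ does not divide $|D|$.
   Context: A $2$-$(v,k,\lambda)$ design $\mathcal{D}=(\mathcal{P},\mathcal{B})$: $\mathcal{P}$ is a set of $v$ points, $\mathcal{B}$ a set of $b$ blocks, each a $k$-subset of $\mathcal{P}$, each pair of distinct points lying in exactly $\lambda$ blocks, with $2<k<v$; $r$ is the number of blocks containing a given point. Automorphisms are permutations of $\mathcal{P}$ preserving $\mathcal{B}$; a flag is a pair $(\alpha,B)$ with $\alpha\in B\in\mathcal{B}$. Hypothesis H: (a) $\mathcal{D}$ is such a design; (b) $G$ is a group of automorphisms of $\mathcal{D}$ transitive on flags, leaving invariant a partition $\mathcal{C}=\{\Delta_1,\dots,\Delta_d\}$ of $\mathcal{P}$ with $d\geq 2$ classes each of size $c\geq 2$; $D=G^{\mathcal{C}}$ is the permutation group induced by $G$ on $\mathcal{C}$, $L=(G_\Delta)^\Delta$ is the permutation group induced on a class $\Delta\in\mathcal{C}$ by its setwise stabiliser $G_\Delta$, $G$ is regarded as a subgroup of $L\wr D$, and $K=G_{(\mathcal{C})}$ is the kernel of the action of $G$ on $\mathcal{C}$; (c) for every block $B$ and class $\Delta$ with $B\cap\Delta\neq\emptyset$ the size $\ell=|B\cap\Delta|$ is independent of $B,\Delta$, and $\ell\geq 2$. -}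

module Defs where

open import Data.Nat using (ℕ; _≤_; _<_; _*_; _∸_)
open import Data.Fin using (Fin)
open import Data.Fin.Subset using (Subset; _∈_; ∣_∣)
open import Data.Fin.Subset.Properties using (_∈?_)
open import Data.Fin.Permutation using (Permutation′; _⟨$⟩ʳ_; _⟨$⟩ˡ_; id; _∘ₚ_; flip)
open import Data.List using (List; length; filter)
open import Data.List using () renaming (allFin to allFinL)
open import Data.Vec using (Vec; lookup)
open import Data.Product using (Σ; ∃; _×_; _,_)
open import Relation.Nullary using (¬_; Dec; _×-dec_)
open import Relation.Unary using (Decidable)
open import Relation.Binary.PropositionalEquality using (_≡_; _≢_)
open import Data.Fin using (_≟_)
open import Function.Bundles using (_⇔_)

count : ∀ {n} {P : Fin n → Set} → Decidable P → ℕ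
count {n} P? = length (filter P? (allFinL n))

-- A design on point set Fin v with b blocks given by an indexing B : Fin b → Subset v.
-- Blocks are distinct (B injective), so the block set has exactly b elements.
record Is2Design (v k λ' b : ℕ) (B : Fin b → Subset v) : Set where
  field
    k-bounds     : 2 < k × k < v
    blocks-distinct : ∀ i j → B i ≡ B j → i ≡ j
    block-size   : ∀ i → ∣ B i ∣ ≡ k
    balanced     : ∀ (x y : Fin v) → x ≢ y →
                   count (λ i → (x ∈? B i) ×-dec (y ∈? B i)) ≡ λ'

_≈ₚ_ : ∀ {n} → Permutation′ n → Permutation′ n → Set
σ ≈ₚ τ = ∀ i → σ ⟨$⟩ʳ i ≡ τ ⟨$⟩ʳ i

record IsPermGroup {n : ℕ} (G : Permutation′ n → Set) : Set where
  field
    has-id   : G id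
    closed-∘ : ∀ σ τ → G σ → G τ → G (σ ∘ₚ τ)
    closed-⁻¹ : ∀ σ → G σ → G (flip σ)

MapsBlock : ∀ {v b} → (B : Fin b → Subset v) → Permutation′ v → Fin b → Fin b → Set
MapsBlock B g i j = ∀ x → (x ∈ B i) ⇔ ((g ⟨$⟩ʳ x) ∈ B j)

IsAut : ∀ {v b} → (B : Fin b → Subset v) → Permutation′ v → Set
IsAut B g = ∀ i → ∃ λ j → MapsBlock B g i j

FlagTransitive : ∀ {v b} → (B : Fin b → Subset v) → (Permutation′ v → Set) → Set
FlagTransitive B G = ∀ x i y j → x ∈ B i → y ∈ B j →
  ∃ λ g → G g × (g ⟨$⟩ʳ x ≡ y) × MapsBlock B g i j

IsUniformPartition : ∀ {v} (d c : ℕ) → (Fin v → Fin d) → Set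
IsUniformPartition d c cls = ∀ δ → count (λ x → cls x ≟ δ) ≡ c

PreservesPartition : ∀ {v d} → (Fin v → Fin d) → (Permutation′ v → Set) → Set
PreservesPartition cls G = ∀ g → G g → ∀ x y → cls x ≡ cls y →
  cls (g ⟨$⟩ʳ x) ≡ cls (g ⟨$⟩ʳ y)

-- The permutation group D = G^C induced by G on the set of classes
Induced : ∀ {v d} → (Fin v → Fin d) → (Permutation′ v → Set) → Permutation′ d → Set
Induced cls G σ = ∃ λ g → G g × (∀ x → cls (g ⟨$⟩ʳ x) ≡ σ ⟨$⟩ʳ cls x)

-- A set of permutations P has exactly m elements (counted up to pointwise equality)
HasOrder : ∀ {n} → (Permutation′ n → Set) → ℕ → Set
HasOrder {n} P m = Σ (Vec (Permutation′ n) m) λ xs →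
  (∀ i → P (lookup xs i)) ×
  (∀ σ → P σ → ∃ λ i → lookup xs i ≈ₚ σ) ×
  (∀ i j → lookup xs i ≈ₚ lookup xs j → i ≡ j)

meet : ∀ {v b d} → (B : Fin b → Subset v) → (Fin v → Fin d) → Fin b → Fin d → ℕ
meet B cls i δ = count (λ x → (x ∈? B i) ×-dec (cls x ≟ δ))

{-# OPTIONS --safe #-}
-- Suppose p divides |D|. By Cauchy's theorem some g ∈ G induces a permutation σ of order p on the
-- classes. Writing b! = pᵃ m with p ∤ m, the power gᵐ permutes the b blocks with p-power order, so,
-- as p ∤ b, it fixes some block B. The k / ℓ classes met by B are permuted by σᵐ, which still has
-- order p; since k / ℓ < p they are all fixed by σᵐ. But a permutation of order p of d points fixes
-- at most d - p of them, contradicting d - p < k / ℓ.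
module Submission where

open import Defs
open import Data.Nat using (ℕ; _≤_; _<_; _*_; _∸_)
open import Data.Nat.Divisibility using (_∣_)
open import Data.Nat.Primality using (Prime)
open import Data.Fin using (Fin)
open import Data.Fin.Subset using (Subset)
open import Data.Fin.Permutation using (Permutation′)
open import Relation.Nullary using (¬_)
open import Relation.Binary.PropositionalEquality using (_≡_; _≢_)

open import Level using (0ℓ)
open import Algebra.Bundles using (Group)
open import Algebra.Core using (Op₁; Op₂)
open import Algebra.Structures using (IsGroup)
import Algebra.Properties.Monoid.Mult as MonoidMult
open import Data.Nat using (zero; suc; _+_; _^_; _!; z≤n; s≤s; s≤s⁻¹; NonZero; >-nonZero; >-nonZero⁻¹; nonTrivial⇒n>1) renaming (_≟_ to _≟ℕ_)
open import Data.Nat.Properties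
open import Algebra.Properties.CommutativeSemigroup +-commutativeSemigroup using (interchange; x∙yz≈y∙xz)
open import Data.Nat.ListAction using (sum)
open import Data.Nat.Coprimality using (Coprime; coprime-Bézout)
import Data.Nat.GCD as GCD
open import Data.Nat.DivMod using (_%_; _/_; m≡m%n+[m/n]*n; m%n<n)
open import Data.Nat.Divisibility using (divides; _∣?_; >⇒∤; ∣⇒≤; ∣m+n∣m⇒∣n; m∣m*n; ∣m⇒∣m*n; ∣-trans; m≤n⇒m!∣n!)
open import Data.Nat.Induction using (<-rec)
open import Data.Nat.Primality using (prime⇒irreducible; prime⇒nonZero; prime⇒nonTrivial; ¬prime[0]; ¬prime[1])
open import Data.Fin using (toℕ; fromℕ<) renaming (zero to fzero; suc to fsuc; _≟_ to _≟ᶠ_)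
open import Data.Fin.Properties using (any?; toℕ-injective; toℕ<n; toℕ-fromℕ<; ¬∀⟶∃¬; pigeonhole) renaming (suc-injective to fsuc-injective)
open import Data.Fin.Permutation using (_⟨$⟩ʳ_; _⟨$⟩ˡ_; _∘ₚ_; flip) renaming (id to idₚ)
import Data.Fin.Permutation as Perm
open import Data.Fin.Subset using (_∈_; ∣_∣; inside; outside)
open import Data.Fin.Subset.Properties using (_∈?_; ⊆-antisym; drop-there)
open import Data.List using (List; []; _∷_; _++_; length; filter; map; concatMap; allFin; tabulate)
open import Data.List.Properties using (filter-accept; filter-reject; filter-++; filter-all; filter-none; filter-≐; filter-notAll; length-++; length-tabulate; map-tabulate; map-cong; ++-identityʳ; ++-assoc)
import Data.List.Relation.Unary.All as All
open import Data.List.Membership.Propositional using (lose)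
open import Data.List.Membership.Propositional.Properties using (∈-allFin)
open import Data.Vec using (Vec; []; _∷_; _∷ʳ_; replicate; toList; head; lookup; foldr′; there)
import Data.Vec.Properties as Vec
open import Data.Product using (∃; ∃₂; _×_; _,_; proj₁; proj₂)
open import Data.Sum using (inj₁; inj₂)
open import Function.Base using (_∘_; id)
open import Function.Bundles using (Equivalence)
open import Function.Definitions using (Injective)
import Function.Endo.Propositional as Endo
open import Relation.Nullary using (Dec; yes; no; ¬?; contradiction)
open import Relation.Nullary.Decidable using (decidable-stable)
open import Relation.Unary using (Pred; Decidable; _⊆_; _≐_; _∩_; ∁)
open import Relation.Unary.Properties using (_∩?_; ∁?; U?)
open import Relation.Binary.Definitions using (DecidableEquality; tri<; tri≈; tri>)
open import Relation.Binary.PropositionalEquality using (refl; sym; trans; cong; cong₂; cong-app; subst; isEquivalence; ≢-sym; module ≡-Reasoning)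

-- Iterated maps

infixr 8 _^ᶠ_

_^ᶠ_ : {A : Set} → (A → A) → ℕ → A → A
_^ᶠ_ {A} = Endo._^_ A

Periodic : {A : Set} → ℕ → (A → A) → Set
Periodic t f = ∀ x → (f ^ᶠ t) x ≡ x

^ᶠ-fixed : {A : Set} (f : A → A) {x : A} → f x ≡ x → ∀ n → (f ^ᶠ n) x ≡ x
^ᶠ-fixed f fx zero = refl
^ᶠ-fixed f fx (suc n) = trans (cong f (^ᶠ-fixed f fx n)) fx

module _ {A : Set} (f : A → A) where

  ^ᶠ-+ : ∀ m n x → (f ^ᶠ (m + n)) x ≡ (f ^ᶠ m) ((f ^ᶠ n) x)
  ^ᶠ-+ m n x = cong-app (Endo.^-homo A f m n) x

  ^ᶠ-* : ∀ m n x → (f ^ᶠ (m * n)) x ≡ ((f ^ᶠ n) ^ᶠ m) x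
  ^ᶠ-* m n x = sym (cong-app (MonoidMult.×-assocˡ (Endo.∘-id-monoid A) f m n) x)

  ^ᶠ-suc : ∀ n x → (f ^ᶠ suc n) x ≡ (f ^ᶠ n) (f x)
  ^ᶠ-suc n x = trans (cong (λ t → (f ^ᶠ t) x) (+-comm 1 n)) (^ᶠ-+ n 1 x)

  ^ᶠ-periodic : ∀ {n x} → (f ^ᶠ n) x ≡ x → ∀ m → (f ^ᶠ (m * n)) x ≡ x
  ^ᶠ-periodic {n} {x} fⁿx m = trans (^ᶠ-* m n x) (^ᶠ-fixed (f ^ᶠ n) fⁿx m)

  -- Bézout gives 1 + w n = u m or 1 + u m = w n, and multiples of periods are periods.
  coprime-periods⇒fixed : ∀ {m n x} → Coprime m n →
                          (f ^ᶠ m) x ≡ x → (f ^ᶠ n) x ≡ x → f x ≡ x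
  coprime-periods⇒fixed {m} {n} {x} cop fᵐx fⁿx with coprime-Bézout cop
  ... | GCD.Bézout.+- u w 1+wn≡um = begin
    f x                    ≡⟨ cong f (^ᶠ-periodic fⁿx w) ⟨
    (f ^ᶠ (1 + w * n)) x   ≡⟨ cong (λ t → (f ^ᶠ t) x) 1+wn≡um ⟩
    (f ^ᶠ (u * m)) x       ≡⟨ ^ᶠ-periodic fᵐx u ⟩
    x                      ∎ where open ≡-Reasoning
  ... | GCD.Bézout.-+ u w 1+um≡wn = begin
    f x                    ≡⟨ cong f (^ᶠ-periodic fᵐx u) ⟨
    (f ^ᶠ (1 + u * m)) x   ≡⟨ cong (λ t → (f ^ᶠ t) x) 1+um≡wn ⟩
    (f ^ᶠ (w * n)) x       ≡⟨ ^ᶠ-periodic fⁿx w ⟩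
    x                      ∎ where open ≡-Reasoning

^ᶠ-natural : {A B : Set} {f : A → A} {g : B → B} (h : A → B) → (∀ x → h (f x) ≡ g (h x)) →
             ∀ n x → h ((f ^ᶠ n) x) ≡ (g ^ᶠ n) (h x)
^ᶠ-natural h comm zero x = refl
^ᶠ-natural {g = g} h comm (suc n) x = trans (comm _) (cong g (^ᶠ-natural h comm n x))

^ᶠ-injective : ∀ {A : Set} {f : A → A} → Injective _≡_ _≡_ f → ∀ t → Injective _≡_ _≡_ (f ^ᶠ t)
^ᶠ-injective f-inj zero eq = eq
^ᶠ-injective f-inj (suc t) eq = ^ᶠ-injective f-inj t (f-inj eq)

^ᶠ-periodic-power : ∀ {A : Set} {f : A → A} {p} → Periodic p f → ∀ m → Periodic p (f ^ᶠ m)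
^ᶠ-periodic-power {f = f} {p} fᵖ≡id m x = begin
  ((f ^ᶠ m) ^ᶠ p) x    ≡⟨ ^ᶠ-* f p m x ⟨
  (f ^ᶠ (p * m)) x     ≡⟨ cong (λ t → (f ^ᶠ t) x) (*-comm p m) ⟩
  (f ^ᶠ (m * p)) x     ≡⟨ ^ᶠ-* f m p x ⟩
  ((f ^ᶠ p) ^ᶠ m) x    ≡⟨ ^ᶠ-fixed (f ^ᶠ p) (fᵖ≡id x) m ⟩
  x                    ∎
  where open ≡-Reasoning

prime∤⇒coprime : ∀ {p m} → Prime p → ¬ p ∣ m → Coprime m p
prime∤⇒coprime pp p∤m (d∣m , d∣p) with prime⇒irreducible pp d∣p
... | inj₁ d≡1 = d≡1
... | inj₂ refl = contradiction d∣m p∤m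

prime-period⇒fixed : ∀ {A : Set} (f : A → A) {p m x} → Prime p → ¬ p ∣ m →
                     (f ^ᶠ p) x ≡ x → (f ^ᶠ m) x ≡ x → f x ≡ x
prime-period⇒fixed f pp p∤m fᵖx fᵐx = coprime-periods⇒fixed f (prime∤⇒coprime pp p∤m) fᵐx fᵖx

-- Counting in lists

module _ {A : Set} where

  countIn : {P : Pred A 0ℓ} → Decidable P → List A → ℕ
  countIn P? xs = length (filter P? xs)

  module _ {P : Pred A 0ℓ} (P? : Decidable P) where

    countIn-accept : ∀ {x xs} → P x → countIn P? (x ∷ xs) ≡ suc (countIn P? xs)
    countIn-accept px = cong length (filter-accept P? px)

    countIn-reject : ∀ {x xs} → ¬ P x → countIn P? (x ∷ xs) ≡ countIn P? xs
    countIn-reject ¬px = cong length (filter-reject P? ¬px)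

    countIn-++ : ∀ xs ys → countIn P? (xs ++ ys) ≡ countIn P? xs + countIn P? ys
    countIn-++ xs ys = trans (cong length (filter-++ P? xs ys)) (length-++ (filter P? xs))

    countIn-universal : (∀ x → P x) → ∀ xs → countIn P? xs ≡ length xs
    countIn-universal all xs = cong length (filter-all P? (All.universal all xs))

    countIn-empty : (∀ x → ¬ P x) → ∀ xs → countIn P? xs ≡ 0
    countIn-empty none xs = cong length (filter-none P? (All.universal none xs))

    countIn≢0⇒∃ : ∀ xs → countIn P? xs ≢ 0 → ∃ P
    countIn≢0⇒∃ [] ne = contradiction refl ne
    countIn≢0⇒∃ (x ∷ xs) ne with P? x
    ... | yes px = x , px
    ... | no _ = countIn≢0⇒∃ xs ne

  module _ {P Q : Pred A 0ℓ} (P? : Decidable P) (Q? : Decidable Q) where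

    countIn-≐ : P ≐ Q → ∀ xs → countIn P? xs ≡ countIn Q? xs
    countIn-≐ P≐Q xs = cong length (filter-≐ P? Q? P≐Q xs)

    countIn-mono : P ⊆ Q → ∀ xs → countIn P? xs ≤ countIn Q? xs
    countIn-mono P⊆Q [] = z≤n
    countIn-mono P⊆Q (x ∷ xs) with P? x
    ... | yes px = ≤-trans (s≤s (countIn-mono P⊆Q xs)) (≤-reflexive (sym (countIn-accept Q? (P⊆Q px))))
    ... | no _ with Q? x
    ...   | yes _ = m≤n⇒m≤1+n (countIn-mono P⊆Q xs)
    ...   | no _ = countIn-mono P⊆Q xs

    countIn-split : ∀ xs → countIn P? xs ≡ countIn (P? ∩? Q?) xs + countIn (P? ∩? ∁? Q?) xs
    countIn-split [] = refl
    countIn-split (x ∷ xs) with P? x | Q? x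
    ... | yes _ | yes _ = cong suc (countIn-split xs)
    ... | yes _ | no _ = trans (cong suc (countIn-split xs)) (sym (+-suc _ _))
    ... | no _ | _ = countIn-split xs

  countIn-concatMap : {B : Set} {P : Pred A 0ℓ} (P? : Decidable P) (f : B → List A) →
                      ∀ ys → countIn P? (concatMap f ys) ≡ sum (map (countIn P? ∘ f) ys)
  countIn-concatMap P? f [] = refl
  countIn-concatMap P? f (y ∷ ys) =
    trans (countIn-++ P? (f y) (concatMap f ys)) (cong (countIn P? (f y) +_) (countIn-concatMap P? f ys))

  sum-map-indicator : {Q : Pred A 0ℓ} (Q? : Decidable Q) (g : A → ℕ) (c : ℕ) →
                      (∀ {y} → Q y → g y ≡ c) → (∀ {y} → ¬ Q y → g y ≡ 0) →
                      ∀ ys → sum (map g ys) ≡ countIn Q? ys * c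
  sum-map-indicator Q? g c on off [] = refl
  sum-map-indicator Q? g c on off (y ∷ ys) with Q? y
  ... | yes q = cong₂ _+_ (on q) (sum-map-indicator Q? g c on off ys)
  ... | no ¬q = cong₂ _+_ (off ¬q) (sum-map-indicator Q? g c on off ys)

  sum-map-+ : (g h : A → ℕ) → ∀ ys → sum (map (λ y → g y + h y) ys) ≡ sum (map g ys) + sum (map h ys)
  sum-map-+ g h [] = refl
  sum-map-+ g h (y ∷ ys) = trans (cong (g y + h y +_) (sum-map-+ g h ys)) (interchange (g y) (h y) _ _)

countIn-map : {A B : Set} {P : Pred B 0ℓ} (P? : Decidable P) (f : A → B) →
              ∀ xs → countIn P? (map f xs) ≡ countIn (P? ∘ f) xs
countIn-map P? f [] = refl
countIn-map P? f (x ∷ xs) with P? (f x)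
... | yes _ = cong suc (countIn-map P? f xs)
... | no _ = countIn-map P? f xs

length-allFin : ∀ n → length (allFin n) ≡ n
length-allFin n = length-tabulate id

record IsEnumeration {A : Set} (_≟_ : DecidableEquality A) (xs : List A) : Set where
  field
    once : ∀ a → countIn (_≟ a) xs ≡ 1

countIn-allFin-suc : ∀ {n} {P : Pred (Fin (suc n)) 0ℓ} (P? : Decidable P) →
                     countIn P? (allFin (suc n)) ≡ countIn P? (fzero ∷ []) + countIn (P? ∘ fsuc) (allFin n)
countIn-allFin-suc {n} P? = begin
  countIn P? (fzero ∷ tabulate fsuc)
    ≡⟨ cong (λ xs → countIn P? (fzero ∷ xs)) (map-tabulate id fsuc) ⟨
  countIn P? ((fzero ∷ []) ++ map fsuc (allFin n))
    ≡⟨ countIn-++ P? (fzero ∷ []) _ ⟩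
  countIn P? (fzero ∷ []) + countIn P? (map fsuc (allFin n))
    ≡⟨ cong (countIn P? (fzero ∷ []) +_) (countIn-map P? fsuc (allFin n)) ⟩
  countIn P? (fzero ∷ []) + countIn (P? ∘ fsuc) (allFin n)
    ∎
  where open ≡-Reasoning

allFin-isEnumeration : ∀ n → IsEnumeration _≟ᶠ_ (allFin n)
allFin-isEnumeration n = record { once = once n }
  where
  once : ∀ n a → countIn (_≟ᶠ a) (allFin n) ≡ 1
  once (suc n) fzero = trans (countIn-allFin-suc {n} (_≟ᶠ fzero))
    (cong suc (countIn-empty ((_≟ᶠ fzero) ∘ fsuc) (λ _ ()) (allFin n)))
  once (suc n) (fsuc a) = trans (countIn-allFin-suc {n} (_≟ᶠ fsuc a))
    (trans (countIn-≐ ((_≟ᶠ fsuc a) ∘ fsuc) (_≟ᶠ a) (fsuc-injective , cong fsuc) (allFin n)) (once n a))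

countIn-fibres : {A : Set} {P : Pred A 0ℓ} (P? : Decidable P) {d : ℕ} (f : A → Fin d) → ∀ xs →
                 countIn P? xs ≡ sum (map (λ δ → countIn (P? ∩? (λ x → f x ≟ᶠ δ)) xs) (allFin d))
countIn-fibres P? {d} f [] =
  sym (trans (sum-map-indicator U? (λ _ → 0) 0 (λ _ → refl) (λ ¬u → contradiction _ ¬u) (allFin d))
             (*-zeroʳ (countIn U? (allFin d))))
countIn-fibres {P = P} P? {d} f (x ∷ xs) = begin
  countIn P? (x ∷ xs)                                    ≡⟨ countIn-++ P? (x ∷ []) xs ⟩
  countIn P? (x ∷ []) + countIn P? xs                    ≡⟨ cong₂ _+_ single-fibre (countIn-fibres P? f xs) ⟩
  sum (map (λ δ → countIn (fibre δ) (x ∷ [])) (allFin d)) + sum (map (λ δ → countIn (fibre δ) xs) (allFin d))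
                                                         ≡⟨ sum-map-+ _ _ (allFin d) ⟨
  sum (map (λ δ → countIn (fibre δ) (x ∷ []) + countIn (fibre δ) xs) (allFin d))
                                                         ≡⟨ cong sum (map-cong (λ δ → countIn-++ (fibre δ) (x ∷ []) xs) (allFin d)) ⟨
  sum (map (λ δ → countIn (fibre δ) (x ∷ xs)) (allFin d)) ∎
  where
  open ≡-Reasoning
  fibre : ∀ δ → Decidable (λ y → P y × f y ≡ δ)
  fibre δ = P? ∩? (λ y → f y ≟ᶠ δ)
  at-image : ∀ {δ} → δ ≡ f x → countIn (fibre δ) (x ∷ []) ≡ countIn P? (x ∷ [])
  at-image refl = by-cases (P? x)
    where
    by-cases : Dec (P x) → countIn (fibre (f x)) (x ∷ []) ≡ countIn P? (x ∷ [])
    by-cases (yes px) = trans (countIn-accept (fibre (f x)) (px , refl)) (sym (countIn-accept P? px))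
    by-cases (no ¬px) = trans (countIn-reject (fibre (f x)) (¬px ∘ proj₁)) (sym (countIn-reject P? ¬px))
  single-fibre : countIn P? (x ∷ []) ≡ sum (map (λ δ → countIn (fibre δ) (x ∷ [])) (allFin d))
  single-fibre = sym (trans (sum-map-indicator (_≟ᶠ f x) _ _ at-image
                                (λ δ≢fx → countIn-reject (fibre _) (δ≢fx ∘ sym ∘ proj₂)) (allFin d))
                            (trans (cong (_* _) (IsEnumeration.once (allFin-isEnumeration d) (f x))) (*-identityˡ _)))

∣s∣≡count-∈ : ∀ {v} (s : Subset v) → ∣ s ∣ ≡ count (_∈? s)
∣s∣≡count-∈ {zero} [] = refl
∣s∣≡count-∈ {suc v} (inside ∷ s) = trans (cong suc (∣s∣≡count-∈ s))
  (sym (trans (countIn-allFin-suc {v} (_∈? (inside ∷ s)))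
              (cong suc (countIn-≐ _ (_∈? s) (drop-there , there) (allFin v)))))
∣s∣≡count-∈ {suc v} (outside ∷ s) = trans (∣s∣≡count-∈ s)
  (sym (trans (countIn-allFin-suc {v} (_∈? (outside ∷ s)))
              (countIn-≐ _ (_∈? s) (drop-there , there) (allFin v))))

-- Fixed points of maps of prime-power order

Fixed : {A : Set} → (A → A) → Pred A 0ℓ
Fixed f x = f x ≡ x

module Enumeration {A : Set} {_≟_ : DecidableEquality A} {xs : List A} (enum : IsEnumeration _≟_ xs) where

  open IsEnumeration enum

  fixed? : (f : A → A) → Decidable (Fixed f)
  fixed? f x = f x ≟ x

  countIn-pos : {P : Pred A 0ℓ} (P? : Decidable P) → ∀ {a} → P a → 1 ≤ countIn P? xs
  countIn-pos P? {a} pa = subst (_≤ countIn P? xs) (once a) (countIn-mono (_≟ a) P? (λ { refl → pa }) xs)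

  countIn-image : ∀ {k} (f : Fin k → A) → Injective _≡_ _≡_ f →
                  countIn (λ x → any? (λ i → x ≟ f i)) xs ≡ k
  countIn-image {zero} f f-inj = countIn-empty _ (λ { _ (() , _) }) xs
  countIn-image {suc k} f f-inj = begin
    countIn image? xs                                                   ≡⟨ countIn-split image? (_≟ f fzero) xs ⟩
    countIn (image? ∩? (_≟ f fzero)) xs + countIn (image? ∩? ∁? (_≟ f fzero)) xs
      ≡⟨ cong₂ _+_ (trans (countIn-≐ _ (_≟ f fzero) (proj₂ , λ x≡f0 → (fzero , x≡f0) , x≡f0) xs) (once (f fzero)))
                   (trans (countIn-≐ _ _ (image-tail , image-tail⁻¹) xs)
                          (countIn-image (f ∘ fsuc) (fsuc-injective ∘ f-inj))) ⟩
    1 + k                                                               ∎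
    where
    open ≡-Reasoning
    image? = λ x → any? (λ i → x ≟ f i)
    image-tail : ∀ {x} → (∃ λ i → x ≡ f i) × ¬ x ≡ f fzero → ∃ λ i → x ≡ f (fsuc i)
    image-tail ((fzero , x≡f0) , x≢f0) = contradiction x≡f0 x≢f0
    image-tail ((fsuc i , x≡fi) , _) = i , x≡fi
    image-tail⁻¹ : ∀ {x} → (∃ λ i → x ≡ f (fsuc i)) → (∃ λ i → x ≡ f i) × ¬ x ≡ f fzero
    image-tail⁻¹ (i , x≡fi) = (fsuc i , x≡fi) , λ x≡f0 → case (f-inj (trans (sym x≡fi) x≡f0))
      where case : fsuc i ≢ fzero
            case ()

  module Orbits {p : ℕ} (pp : Prime p) (ρ : A → A) where

    instance
      p≢0 : NonZero p
      p≢0 = prime⇒nonZero pp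

    module Orbit {P : Pred A 0ℓ} (closed : ∀ {x} → P x → P (ρ x)) (periodic : ∀ {x} → P x → (ρ ^ᶠ p) x ≡ x)
                 {y : A} (Py : P y) (¬fixed-y : ¬ Fixed ρ y) where

      orbit : ℕ → A
      orbit i = (ρ ^ᶠ i) y

      InOrbit : Pred A 0ℓ
      InOrbit x = ∃ λ (i : Fin p) → x ≡ orbit (toℕ i)

      inOrbit? : Decidable InOrbit
      inOrbit? x = any? (λ i → x ≟ orbit (toℕ i))

      P-orbit : ∀ i → P (orbit i)
      P-orbit zero = Py
      P-orbit (suc i) = closed (P-orbit i)

      orbit-mod : ∀ i → orbit i ≡ orbit (i % p)
      orbit-mod i = begin
        orbit i                                  ≡⟨ cong orbit (m≡m%n+[m/n]*n i p) ⟩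
        orbit (i % p + i / p * p)                ≡⟨ ^ᶠ-+ ρ (i % p) (i / p * p) y ⟩
        (ρ ^ᶠ (i % p)) ((ρ ^ᶠ (i / p * p)) y)   ≡⟨ cong (ρ ^ᶠ (i % p)) (^ᶠ-periodic ρ (periodic Py) (i / p)) ⟩
        orbit (i % p)                            ∎
        where open ≡-Reasoning

      orbit-inOrbit : ∀ i → InOrbit (orbit i)
      orbit-inOrbit i = fromℕ< (m%n<n i p) , trans (orbit-mod i) (cong orbit (sym (toℕ-fromℕ< (m%n<n i p))))

      orbit-not-fixed : ∀ {i} → i ≤ p → ¬ Fixed ρ (orbit i)
      orbit-not-fixed {i} i≤p fixed = ¬fixed-y (subst (Fixed ρ) (sym y≡orbit-i) fixed)
        where
        y≡orbit-i : y ≡ orbit i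
        y≡orbit-i = begin
          y                                ≡⟨ periodic Py ⟨
          orbit p                          ≡⟨ cong orbit (m∸n+n≡m i≤p) ⟨
          orbit (p ∸ i + i)                ≡⟨ ^ᶠ-+ ρ (p ∸ i) i y ⟩
          (ρ ^ᶠ (p ∸ i)) (orbit i)         ≡⟨ ^ᶠ-fixed ρ fixed (p ∸ i) ⟩
          orbit i                          ∎
          where open ≡-Reasoning

      -- Two orbit points at distance 0 < j - i < p would make orbit i fixed, as p is prime.
      orbit-distinct : ∀ {i j} → i < j → j < p → orbit i ≢ orbit j
      orbit-distinct {i} {j} i<j j<p orbit-i≡orbit-j =
        orbit-not-fixed (<⇒≤ (<-trans i<j j<p))
          (prime-period⇒fixed ρ pp (>⇒∤ {{>-nonZero (m<n⇒0<n∸m i<j)}} (≤-<-trans (m∸n≤m j i) j<p))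
            (periodic (P-orbit i)) period)
        where
        period : (ρ ^ᶠ (j ∸ i)) (orbit i) ≡ orbit i
        period = begin
          (ρ ^ᶠ (j ∸ i)) (orbit i)   ≡⟨ ^ᶠ-+ ρ (j ∸ i) i y ⟨
          orbit (j ∸ i + i)          ≡⟨ cong orbit (m∸n+n≡m (<⇒≤ i<j)) ⟩
          orbit j                    ≡⟨ orbit-i≡orbit-j ⟨
          orbit i                    ∎
          where open ≡-Reasoning

      orbit-injective : Injective _≡_ _≡_ (orbit ∘ toℕ {p})
      orbit-injective {i} {j} eq with <-cmp (toℕ i) (toℕ j)
      ... | tri< i<j _ _ = contradiction eq (orbit-distinct i<j (toℕ<n j))
      ... | tri≈ _ i≡j _ = toℕ-injective i≡j
      ... | tri> _ _ i>j = contradiction (sym eq) (orbit-distinct i>j (toℕ<n i))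

      inOrbit-preimage : ∀ {x} → P x → InOrbit (ρ x) → InOrbit x
      inOrbit-preimage {x} Px (i , ρx≡orbit-i) = subst InOrbit (sym x≡orbit) (orbit-inOrbit (p ∸ 1 + toℕ i))
        where
        x≡orbit : x ≡ orbit (p ∸ 1 + toℕ i)
        x≡orbit = begin
          x                                   ≡⟨ periodic Px ⟨
          (ρ ^ᶠ p) x                          ≡⟨ cong (λ t → (ρ ^ᶠ t) x) (m∸n+n≡m (>-nonZero⁻¹ p)) ⟨
          (ρ ^ᶠ (p ∸ 1 + 1)) x                ≡⟨ ^ᶠ-+ ρ (p ∸ 1) 1 x ⟩
          (ρ ^ᶠ (p ∸ 1)) (ρ x)                ≡⟨ cong (ρ ^ᶠ (p ∸ 1)) ρx≡orbit-i ⟩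
          (ρ ^ᶠ (p ∸ 1)) (orbit (toℕ i))      ≡⟨ ^ᶠ-+ ρ (p ∸ 1) (toℕ i) y ⟨
          orbit (p ∸ 1 + toℕ i)               ∎
          where open ≡-Reasoning

      module _ (P? : Decidable P) where

        outside? : Decidable (P ∩ ∁ InOrbit)
        outside? = P? ∩? ∁? inOrbit?

        outside-closed : ∀ {x} → (P ∩ ∁ InOrbit) x → (P ∩ ∁ InOrbit) (ρ x)
        outside-closed (Px , ¬in) = closed Px , ¬in ∘ inOrbit-preimage Px

        countIn-remove-orbit : countIn P? xs ≡ p + countIn outside? xs
        countIn-remove-orbit = begin
          countIn P? xs                                          ≡⟨ countIn-split P? inOrbit? xs ⟩
          countIn (P? ∩? inOrbit?) xs + countIn outside? xs      ≡⟨ cong (_+ countIn outside? xs) orbit-size ⟩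
          p + countIn outside? xs                                ∎
          where
          open ≡-Reasoning
          orbit-size : countIn (P? ∩? inOrbit?) xs ≡ p
          orbit-size = trans (countIn-≐ _ inOrbit? (proj₂ , λ { x∈@(i , refl) → P-orbit (toℕ i) , x∈ }) xs)
                             (countIn-image (orbit ∘ toℕ) orbit-injective)

        countIn-fixed-outside : countIn (outside? ∩? fixed? ρ) xs ≡ countIn (P? ∩? fixed? ρ) xs
        countIn-fixed-outside = countIn-≐ _ _
          ((λ ((Px , _) , fixed) → Px , fixed) ,
           (λ (Px , fixed) → (Px , λ { (i , refl) → orbit-not-fixed (<⇒≤ (toℕ<n i)) fixed }) , fixed))
          xs

    -- The non-fixed points of P fall into orbits of exactly p points, removed here one at a time.
    countIn-fixed-mod : ∀ {P : Pred A 0ℓ} (P? : Decidable P) →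
                        (∀ {x} → P x → P (ρ x)) → (∀ {x} → P x → (ρ ^ᶠ p) x ≡ x) →
                        ∃ λ q → countIn P? xs ≡ countIn (P? ∩? fixed? ρ) xs + p * q
    countIn-fixed-mod P? closed periodic = <-rec Goal step _ P? closed periodic refl
      where
      Goal : ℕ → Set₁
      Goal n = ∀ {P : Pred A 0ℓ} (P? : Decidable P) →
               (∀ {x} → P x → P (ρ x)) → (∀ {x} → P x → (ρ ^ᶠ p) x ≡ x) →
               countIn P? xs ≡ n → ∃ λ q → countIn P? xs ≡ countIn (P? ∩? fixed? ρ) xs + p * q
      step : ∀ n → (∀ {m} → m < n → Goal m) → Goal n
      step n rec P? closed periodic refl with countIn (P? ∩? ∁? (fixed? ρ)) xs ≟ℕ 0
      ... | yes none = 0 , (begin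
        countIn P? xs
          ≡⟨ countIn-split P? (fixed? ρ) xs ⟩
        countIn (P? ∩? fixed? ρ) xs + countIn (P? ∩? ∁? (fixed? ρ)) xs
          ≡⟨ cong (countIn (P? ∩? fixed? ρ) xs +_) (trans none (sym (*-zeroʳ p))) ⟩
        countIn (P? ∩? fixed? ρ) xs + p * 0
          ∎)
        where open ≡-Reasoning
      ... | no some with countIn≢0⇒∃ (P? ∩? ∁? (fixed? ρ)) xs some
      ...   | y , Py , ¬fixed-y with rec smaller (outside? P?) (outside-closed P?) (periodic ∘ proj₁) refl
        where
        open Orbit closed periodic Py ¬fixed-y
        smaller : countIn (outside? P?) xs < countIn P? xs
        smaller = subst (countIn (outside? P?) xs <_) (sym (countIn-remove-orbit P?))
                        (m<n+m _ (>-nonZero⁻¹ p))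
      ...     | q , eq = suc q , (begin
        countIn P? xs                              ≡⟨ countIn-remove-orbit P? ⟩
        p + countIn (outside? P?) xs               ≡⟨ cong (p +_) eq ⟩
        p + (countIn (outside? P? ∩? fixed? ρ) xs + p * q)
                                                   ≡⟨ cong (λ c → p + (c + p * q)) (countIn-fixed-outside P?) ⟩
        p + (F + p * q)                            ≡⟨ +-*-suc-shuffle ⟩
        F + p * suc q                              ∎)
        where
        open Orbit closed periodic Py ¬fixed-y
        open ≡-Reasoning
        F = countIn (P? ∩? fixed? ρ) xs
        +-*-suc-shuffle : p + (F + p * q) ≡ F + p * suc q
        +-*-suc-shuffle = trans (x∙yz≈y∙xz p F (p * q)) (cong (F +_) (sym (*-suc p q)))

  open Orbits using (countIn-fixed-mod)

  countIn-fixed-mod-prime-power : ∀ {p} → Prime p → ∀ a (ρ : A → A) → Periodic (p ^ a) ρ →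
                                  ∃ λ q → length xs ≡ countIn (fixed? ρ) xs + p * q
  countIn-fixed-mod-prime-power {p} pp zero ρ ρ-id = 0 , (begin
    length xs                       ≡⟨ countIn-universal (fixed? ρ) ρ-id xs ⟨
    countIn (fixed? ρ) xs           ≡⟨ +-identityʳ _ ⟨
    countIn (fixed? ρ) xs + 0       ≡⟨ cong (countIn (fixed? ρ) xs +_) (*-zeroʳ p) ⟨
    countIn (fixed? ρ) xs + p * 0   ∎)
    where open ≡-Reasoning
  countIn-fixed-mod-prime-power {p} pp (suc a) ρ ρ-id
    with countIn-fixed-mod-prime-power pp a (ρ ^ᶠ p)
           (λ x → trans (sym (^ᶠ-* ρ (p ^ a) p x)) (trans (cong (λ t → (ρ ^ᶠ t) x) (*-comm (p ^ a) p)) (ρ-id x)))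
       | countIn-fixed-mod pp ρ (fixed? (ρ ^ᶠ p))
           (λ {x} ρᵖx≡x → trans (sym (^ᶠ-suc ρ p x)) (cong ρ ρᵖx≡x)) (λ ρᵖx≡x → ρᵖx≡x)
  ... | q₁ , length≡ | q₂ , fixedᵖ≡ = q₂ + q₁ , (begin
    length xs                                                    ≡⟨ length≡ ⟩
    countIn (fixed? (ρ ^ᶠ p)) xs + p * q₁                        ≡⟨ cong (_+ p * q₁) fixedᵖ≡ ⟩
    countIn (fixed? (ρ ^ᶠ p) ∩? fixed? ρ) xs + p * q₂ + p * q₁   ≡⟨ cong (λ c → c + p * q₂ + p * q₁) fixed-both ⟩
    F + p * q₂ + p * q₁                                          ≡⟨ +-assoc F (p * q₂) (p * q₁) ⟩
    F + (p * q₂ + p * q₁)                                        ≡⟨ cong (F +_) (*-distribˡ-+ p q₂ q₁) ⟨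
    F + p * (q₂ + q₁)                                            ∎)
    where
    open ≡-Reasoning
    F = countIn (fixed? ρ) xs
    fixed-both : countIn (fixed? (ρ ^ᶠ p) ∩? fixed? ρ) xs ≡ F
    fixed-both = countIn-≐ _ (fixed? ρ) (proj₂ , λ ρx≡x → ^ᶠ-fixed ρ ρx≡x p , ρx≡x) xs

  countIn≥2⇒∃≢ : {P : Pred A 0ℓ} (P? : Decidable P) → 2 ≤ countIn P? xs → ∀ a → ∃ λ x → P x × x ≢ a
  countIn≥2⇒∃≢ P? 2≤count a = countIn≢0⇒∃ (P? ∩? ∁? (_≟ a)) xs others≢0
    where
    at-a≤1 : countIn (P? ∩? (_≟ a)) xs ≤ 1
    at-a≤1 = subst (countIn (P? ∩? (_≟ a)) xs ≤_) (once a) (countIn-mono _ (_≟ a) proj₂ xs)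
    others≢0 : countIn (P? ∩? ∁? (_≟ a)) xs ≢ 0
    others≢0 none = contradiction (begin
      2                                                          ≤⟨ 2≤count ⟩
      countIn P? xs                                              ≡⟨ countIn-split P? (_≟ a) xs ⟩
      countIn (P? ∩? (_≟ a)) xs + countIn (P? ∩? ∁? (_≟ a)) xs    ≡⟨ cong (countIn (P? ∩? (_≟ a)) xs +_) none ⟩
      countIn (P? ∩? (_≟ a)) xs + 0                              ≡⟨ +-identityʳ _ ⟩
      countIn (P? ∩? (_≟ a)) xs                                  ≤⟨ at-a≤1 ⟩
      1                                                          ∎) λ { (s≤s ()) }
      where open ≤-Reasoning

-- Cauchy's theorem

module _ {A : Set} where

  vectors : List A → ∀ k → List (Vec A k)
  vectors xs zero = [] ∷ []
  vectors xs (suc k) = concatMap (λ x → map (x ∷_) (vectors xs k)) xs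

  vectors-isEnumeration : {_≟_ : DecidableEquality A} {xs : List A} → IsEnumeration _≟_ xs →
                          ∀ k → IsEnumeration (Vec.≡-dec _≟_) (vectors xs k)
  vectors-isEnumeration {_≟_} {xs} enum k = record { once = once k }
    where
    open IsEnumeration enum using () renaming (once to onceˣ)

    _≟ⱽ_ : ∀ {m} → DecidableEquality (Vec A m)
    _≟ⱽ_ = Vec.≡-dec _≟_

    once : ∀ k (as : Vec A k) → countIn (_≟ⱽ as) (vectors xs k) ≡ 1
    once zero [] = refl
    once (suc k) (a ∷ as) = begin
      countIn (_≟ⱽ (a ∷ as)) (vectors xs (suc k))                 ≡⟨ countIn-concatMap (_≟ⱽ (a ∷ as)) _ xs ⟩
      sum (map (λ x → countIn (_≟ⱽ (a ∷ as)) (map (x ∷_) (vectors xs k))) xs)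
        ≡⟨ sum-map-indicator (_≟ a) _ 1 head-match head-mismatch xs ⟩
      countIn (_≟ a) xs * 1                                        ≡⟨ cong (_* 1) (onceˣ a) ⟩
      1                                                            ∎
      where
      open ≡-Reasoning
      head-match : ∀ {x} → x ≡ a → countIn (_≟ⱽ (a ∷ as)) (map (x ∷_) (vectors xs k)) ≡ 1
      head-match refl = trans (countIn-map (_≟ⱽ (a ∷ as)) (a ∷_) (vectors xs k))
        (trans (countIn-≐ _ (_≟ⱽ as) (Vec.∷-injectiveʳ , cong (a ∷_)) (vectors xs k)) (once k as))
      head-mismatch : ∀ {x} → ¬ x ≡ a → countIn (_≟ⱽ (a ∷ as)) (map (x ∷_) (vectors xs k)) ≡ 0
      head-mismatch x≢a = trans (countIn-map (_≟ⱽ (a ∷ as)) _ (vectors xs k))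
        (countIn-empty _ (λ _ → x≢a ∘ Vec.∷-injectiveˡ) (vectors xs k))

  rotate : ∀ {k} → Vec A (suc k) → Vec A (suc k)
  rotate (x ∷ xs) = xs ∷ʳ x

  private
    rotateᴸ : List A → List A
    rotateᴸ [] = []
    rotateᴸ (x ∷ xs) = xs ++ x ∷ []

    rotateᴸ-++ : ∀ xs ys → (rotateᴸ ^ᶠ length xs) (xs ++ ys) ≡ ys ++ xs
    rotateᴸ-++ [] ys = sym (++-identityʳ ys)
    rotateᴸ-++ (x ∷ xs) ys = begin
      (rotateᴸ ^ᶠ suc (length xs)) (x ∷ xs ++ ys)      ≡⟨ ^ᶠ-suc rotateᴸ (length xs) _ ⟩
      (rotateᴸ ^ᶠ length xs) ((xs ++ ys) ++ x ∷ [])   ≡⟨ cong (rotateᴸ ^ᶠ length xs) (++-assoc xs ys _) ⟩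
      (rotateᴸ ^ᶠ length xs) (xs ++ ys ++ x ∷ [])     ≡⟨ rotateᴸ-++ xs (ys ++ x ∷ []) ⟩
      (ys ++ x ∷ []) ++ xs                            ≡⟨ ++-assoc ys _ xs ⟩
      ys ++ x ∷ xs                                    ∎
      where open ≡-Reasoning

    toList-rotate : ∀ {k} t (v : Vec A (suc k)) → toList ((rotate ^ᶠ t) v) ≡ (rotateᴸ ^ᶠ t) (toList v)
    toList-rotate t v = ^ᶠ-natural toList (λ { (x ∷ xs) → Vec.toList-∷ʳ x xs }) t v

  rotate-period : ∀ {k} (v : Vec A (suc k)) → (rotate ^ᶠ suc k) v ≡ v
  rotate-period {k} v = trans (sym (Vec.cast-is-id refl _))
    (Vec.toList-injective refl _ v (begin
      toList ((rotate ^ᶠ suc k) v)                  ≡⟨ toList-rotate (suc k) v ⟩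
      (rotateᴸ ^ᶠ suc k) (toList v)                 ≡⟨ cong (λ t → (rotateᴸ ^ᶠ t) (toList v)) (Vec.length-toList v) ⟨
      (rotateᴸ ^ᶠ length (toList v)) (toList v)     ≡⟨ cong (rotateᴸ ^ᶠ length (toList v)) (++-identityʳ (toList v)) ⟨
      (rotateᴸ ^ᶠ length (toList v)) (toList v ++ []) ≡⟨ rotateᴸ-++ (toList v) [] ⟩
      toList v                                      ∎))
    where open ≡-Reasoning

  rotate-fixed⇒replicate : ∀ {k} (v : Vec A (suc k)) → rotate v ≡ v → v ≡ replicate (suc k) (head v)
  rotate-fixed⇒replicate (x ∷ xs) rotate-v≡v = cong (x ∷_) (∷ʳ-fixed xs rotate-v≡v)
    where
    ∷ʳ-fixed : ∀ {k} (xs : Vec A k) → xs ∷ʳ x ≡ x ∷ xs → xs ≡ replicate k x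
    ∷ʳ-fixed [] _ = refl
    ∷ʳ-fixed (y ∷ ys) eq with Vec.∷-injective eq
    ... | refl , eq′ = cong (y ∷_) (∷ʳ-fixed ys eq′)

  rotate-replicate : ∀ k (x : A) → rotate (replicate (suc k) x) ≡ replicate (suc k) x
  rotate-replicate zero x = refl
  rotate-replicate (suc k) x = cong (x ∷_) (rotate-replicate k x)

module Cauchy {n : ℕ} {_∙_ : Op₂ (Fin n)} {ε : Fin n} {_⁻¹ : Op₁ (Fin n)}
              (isGroup : IsGroup _≡_ _∙_ ε _⁻¹) where

  private
    group : Group 0ℓ 0ℓ
    group = record { isGroup = isGroup }

  open IsGroup isGroup using (assoc; identityˡ; identityʳ; inverseˡ; _\\_)
  open import Algebra.Properties.Group group using (\\-leftDividesˡ; \\-leftDividesʳ; inverseʳ-unique)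

  product : ∀ {k} → Vec (Fin n) k → Fin n
  product = foldr′ _∙_ ε

  product-∷ʳ : ∀ {k} (w : Vec (Fin n) k) x → product (w ∷ʳ x) ≡ product w ∙ x
  product-∷ʳ [] x = trans (identityʳ x) (sym (identityˡ x))
  product-∷ʳ (y ∷ w) x = trans (cong (y ∙_) (product-∷ʳ w x)) (sym (assoc y (product w) x))

  product-rotate : ∀ {k} (v : Vec (Fin n) (suc k)) → product v ≡ ε → product (rotate v) ≡ ε
  product-rotate (x ∷ w) x∙w≡ε = begin
    product (w ∷ʳ x)    ≡⟨ product-∷ʳ w x ⟩
    product w ∙ x       ≡⟨ cong (_∙ x) (inverseʳ-unique x (product w) x∙w≡ε) ⟩
    (x ⁻¹) ∙ x          ≡⟨ inverseˡ x ⟩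
    ε                   ∎
    where open ≡-Reasoning

  private
    enum : ∀ k → IsEnumeration (Vec.≡-dec _≟ᶠ_) (vectors (allFin n) k)
    enum = vectors-isEnumeration (allFin-isEnumeration n)

  countIn-product≡ : ∀ k c → countIn (λ v → product v ≟ᶠ c) (vectors (allFin n) (suc k)) ≡ n ^ k
  countIn-product≡ zero c = begin
    countIn (λ v → product v ≟ᶠ c) (vectors (allFin n) 1)    ≡⟨ countIn-concatMap _ _ (allFin n) ⟩
    sum (map _ (allFin n))
      ≡⟨ sum-map-indicator (_≟ᶠ c) _ 1 (λ x≡c → countIn-accept (λ v → product v ≟ᶠ c) (trans (identityʳ _) x≡c))
                                       (λ x≢c → countIn-reject (λ v → product v ≟ᶠ c) (x≢c ∘ trans (sym (identityʳ _))))
                                       (allFin n) ⟩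
    countIn (_≟ᶠ c) (allFin n) * 1
      ≡⟨ cong (_* 1) (IsEnumeration.once (allFin-isEnumeration n) c) ⟩
    1                                                           ∎
    where open ≡-Reasoning
  countIn-product≡ (suc k) c = begin
    countIn (λ v → product v ≟ᶠ c) (vectors (allFin n) (2 + k))    ≡⟨ countIn-concatMap _ _ (allFin n) ⟩
    sum (map _ (allFin n))
      ≡⟨ sum-map-indicator U? _ (n ^ k) (λ _ → completions _) (λ ¬u → contradiction _ ¬u) (allFin n) ⟩
    countIn U? (allFin n) * n ^ k    ≡⟨ cong (_* n ^ k) (trans (countIn-universal U? _ (allFin n)) (length-allFin n)) ⟩
    n * n ^ k                        ∎
    where
    open ≡-Reasoning
    completions : ∀ x → countIn (λ v → product v ≟ᶠ c) (map (x ∷_) (vectors (allFin n) (suc k))) ≡ n ^ k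
    completions x = begin
      countIn (λ v → product v ≟ᶠ c) (map (x ∷_) (vectors (allFin n) (suc k)))
        ≡⟨ countIn-map (λ v → product v ≟ᶠ c) (x ∷_) (vectors (allFin n) (suc k)) ⟩
      countIn (λ v → x ∙ product v ≟ᶠ c) (vectors (allFin n) (suc k))
        ≡⟨ countIn-≐ (λ v → x ∙ product v ≟ᶠ c) (λ v → product v ≟ᶠ x \\ c)
                     ((λ x∙v≡c → trans (sym (\\-leftDividesʳ x _)) (cong (x \\_) x∙v≡c)) ,
                      (λ v≡x\\c → trans (cong (x ∙_) v≡x\\c) (\\-leftDividesˡ x c))) (vectors (allFin n) (suc k)) ⟩
      countIn (λ v → product v ≟ᶠ x \\ c) (vectors (allFin n) (suc k))
        ≡⟨ countIn-product≡ k (x \\ c) ⟩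
      n ^ k ∎

  -- McKay: rotation permutes the n ^ (p - 1) solutions of x₁ ⋯ xₚ = ε with period p, so the number
  -- of constant solutions is divisible by p; hence there is one besides ε.
  cauchy : ∀ {p} → Prime p → p ∣ n → ∃ λ x → x ≢ ε × product (replicate p x) ≡ ε
  cauchy {0} pp = contradiction pp ¬prime[0]
  cauchy {1} pp = contradiction pp ¬prime[1]
  cauchy {suc (suc k)} pp p∣n = x , x≢ε , product-xᵖ≡ε
    where
    p = 2 + k
    open Enumeration (enum p) using (fixed?; countIn-pos; countIn≥2⇒∃≢; module Orbits)
    open Orbits pp rotate using (countIn-fixed-mod)
    solution? : Decidable (λ v → product v ≡ ε)
    solution? v = product v ≟ᶠ ε
    constant? = solution? ∩? fixed? rotate
    p∣constants : p ∣ countIn constant? (vectors (allFin n) p)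
    p∣constants with countIn-fixed-mod solution? (λ {v} → product-rotate v) (λ {v} _ → rotate-period v)
    ... | q , eq = ∣m+n∣m⇒∣n (subst (p ∣_) (trans (sym (countIn-product≡ (suc k) ε)) (trans eq (+-comm _ (p * q))))
                                      (∣m⇒∣m*n (n ^ k) p∣n))
                             (m∣m*n q)
    ε-constant : (product (replicate p ε) ≡ ε) × Fixed rotate (replicate p ε)
    ε-constant = product-replicate-ε p , rotate-replicate (suc k) ε
      where
      product-replicate-ε : ∀ j → product (replicate j ε) ≡ ε
      product-replicate-ε zero = refl
      product-replicate-ε (suc j) = trans (identityˡ _) (product-replicate-ε j)
    2≤constants : 2 ≤ countIn constant? (vectors (allFin n) p)
    2≤constants = ≤-trans (s≤s (s≤s z≤n)) (∣⇒≤ {{>-nonZero (countIn-pos constant? ε-constant)}} p∣constants)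
    other = countIn≥2⇒∃≢ constant? 2≤constants (replicate p ε)
    v = proj₁ other
    x = head v
    v≡xᵖ : v ≡ replicate p x
    v≡xᵖ = rotate-fixed⇒replicate v (proj₂ (proj₁ (proj₂ other)))
    x≢ε : x ≢ ε
    x≢ε x≡ε = proj₂ (proj₂ other) (trans v≡xᵖ (cong (replicate p) x≡ε))
    product-xᵖ≡ε : product (replicate p x) ≡ ε
    product-xᵖ≡ε = subst (λ w → product w ≡ ε) v≡xᵖ (proj₁ (proj₁ (proj₂ other)))

-- Finite permutation groups

module FinitePermutationGroup {m n : ℕ} {P : Permutation′ m → Set}
                              (isPermGroup : IsPermGroup P) (order : HasOrder P n) where

  open IsPermGroup isPermGroup

  ⟦_⟧ : Fin n → Permutation′ m
  ⟦ i ⟧ = lookup (proj₁ order) i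

  private
    index : ∀ σ → P σ → Fin n
    index σ Pσ = proj₁ (proj₁ (proj₂ (proj₂ order)) σ Pσ)

    ⟦index⟧ : ∀ σ Pσ → ⟦ index σ Pσ ⟧ ≈ₚ σ
    ⟦index⟧ σ Pσ = proj₂ (proj₁ (proj₂ (proj₂ order)) σ Pσ)

    ⟦⟧-injective : ∀ {i j} → ⟦ i ⟧ ≈ₚ ⟦ j ⟧ → i ≡ j
    ⟦⟧-injective = proj₂ (proj₂ (proj₂ order)) _ _

  ⟦⟧-∈ : ∀ i → P ⟦ i ⟧
  ⟦⟧-∈ = proj₁ (proj₂ order)

  _∙_ : Fin n → Fin n → Fin n
  i ∙ j = index (⟦ i ⟧ ∘ₚ ⟦ j ⟧) (closed-∘ _ _ (⟦⟧-∈ i) (⟦⟧-∈ j))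

  ε : Fin n
  ε = index idₚ has-id

  _⁻¹ : Fin n → Fin n
  i ⁻¹ = index (flip ⟦ i ⟧) (closed-⁻¹ _ (⟦⟧-∈ i))

  ⟦∙⟧ : ∀ i j x → ⟦ i ∙ j ⟧ ⟨$⟩ʳ x ≡ ⟦ j ⟧ ⟨$⟩ʳ (⟦ i ⟧ ⟨$⟩ʳ x)
  ⟦∙⟧ i j = ⟦index⟧ _ _

  ⟦ε⟧ : ∀ x → ⟦ ε ⟧ ⟨$⟩ʳ x ≡ x
  ⟦ε⟧ = ⟦index⟧ _ _

  ⟦⁻¹⟧ : ∀ i x → ⟦ i ⁻¹ ⟧ ⟨$⟩ʳ x ≡ ⟦ i ⟧ ⟨$⟩ˡ x
  ⟦⁻¹⟧ i = ⟦index⟧ _ _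

  isGroup : IsGroup _≡_ _∙_ ε _⁻¹
  isGroup = record
    { isMonoid = record
      { isSemigroup = record
        { isMagma = record { isEquivalence = isEquivalence ; ∙-cong = cong₂ _∙_ }
        ; assoc = λ i j k → ⟦⟧-injective λ x → begin
            ⟦ (i ∙ j) ∙ k ⟧ ⟨$⟩ʳ x                   ≡⟨ ⟦∙⟧ _ k x ⟩
            ⟦ k ⟧ ⟨$⟩ʳ (⟦ i ∙ j ⟧ ⟨$⟩ʳ x)             ≡⟨ cong (⟦ k ⟧ ⟨$⟩ʳ_) (⟦∙⟧ i j x) ⟩
            ⟦ k ⟧ ⟨$⟩ʳ (⟦ j ⟧ ⟨$⟩ʳ (⟦ i ⟧ ⟨$⟩ʳ x))    ≡⟨ ⟦∙⟧ j k _ ⟨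
            ⟦ j ∙ k ⟧ ⟨$⟩ʳ (⟦ i ⟧ ⟨$⟩ʳ x)             ≡⟨ ⟦∙⟧ i _ x ⟨
            ⟦ i ∙ (j ∙ k) ⟧ ⟨$⟩ʳ x                   ∎
        }
      ; identity = (λ i → ⟦⟧-injective λ x → trans (⟦∙⟧ ε i x) (cong (⟦ i ⟧ ⟨$⟩ʳ_) (⟦ε⟧ x)))
                 , (λ i → ⟦⟧-injective λ x → trans (⟦∙⟧ i ε x) (⟦ε⟧ _))
      }
    ; inverse = (λ i → ⟦⟧-injective λ x →
                  trans (⟦∙⟧ _ i x) (trans (cong (⟦ i ⟧ ⟨$⟩ʳ_) (⟦⁻¹⟧ i x)) (trans (Perm.inverseʳ ⟦ i ⟧) (sym (⟦ε⟧ x)))))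
              , (λ i → ⟦⟧-injective λ x →
                  trans (⟦∙⟧ i _ x) (trans (⟦⁻¹⟧ i _) (trans (Perm.inverseˡ ⟦ i ⟧) (sym (⟦ε⟧ x)))))
    ; ⁻¹-cong = cong _⁻¹
    }
    where open ≡-Reasoning

  open Cauchy isGroup using (product; cauchy)

  ⟦power⟧ : ∀ i t x → ⟦ product (replicate t i) ⟧ ⟨$⟩ʳ x ≡ ((⟦ i ⟧ ⟨$⟩ʳ_) ^ᶠ t) x
  ⟦power⟧ i zero x = ⟦ε⟧ x
  ⟦power⟧ i (suc t) x = begin
    ⟦ i ∙ product (replicate t i) ⟧ ⟨$⟩ʳ x            ≡⟨ ⟦∙⟧ i _ x ⟩
    ⟦ product (replicate t i) ⟧ ⟨$⟩ʳ (⟦ i ⟧ ⟨$⟩ʳ x)   ≡⟨ ⟦power⟧ i t _ ⟩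
    ((⟦ i ⟧ ⟨$⟩ʳ_) ^ᶠ t) (⟦ i ⟧ ⟨$⟩ʳ x)              ≡⟨ ^ᶠ-suc (⟦ i ⟧ ⟨$⟩ʳ_) t x ⟨
    ((⟦ i ⟧ ⟨$⟩ʳ_) ^ᶠ suc t) x                       ∎
    where open ≡-Reasoning

  element-of-prime-order : ∀ {p} → Prime p → p ∣ n →
                           ∃ λ σ → P σ × Periodic p (σ ⟨$⟩ʳ_) × ∃ λ x → σ ⟨$⟩ʳ x ≢ x
  element-of-prime-order {p} pp p∣n with cauchy pp p∣n
  ... | i , i≢ε , iᵖ≡ε = ⟦ i ⟧ , ⟦⟧-∈ i , periodic , moved
    where
    periodic : Periodic p (⟦ i ⟧ ⟨$⟩ʳ_)
    periodic x = trans (sym (⟦power⟧ i p x)) (trans (cong (λ j → ⟦ j ⟧ ⟨$⟩ʳ x) iᵖ≡ε) (⟦ε⟧ x))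
    moved : ∃ λ x → ⟦ i ⟧ ⟨$⟩ʳ x ≢ x
    moved = ¬∀⟶∃¬ m _ (λ x → ⟦ i ⟧ ⟨$⟩ʳ x ≟ᶠ x)
                  (λ fixes-all → i≢ε (⟦⟧-injective λ x → trans (fixes-all x) (sym (⟦ε⟧ x))))

induced-isPermGroup : ∀ {v d} {cls : Fin v → Fin d} {G : Permutation′ v → Set} →
                      IsPermGroup G → IsPermGroup (Induced cls G)
induced-isPermGroup {cls = cls} isPermGroup = record
  { has-id = idₚ , has-id , λ _ → refl
  ; closed-∘ = λ { σ τ (g , g∈G , g↦σ) (h , h∈G , h↦τ) →
      g ∘ₚ h , closed-∘ g h g∈G h∈G , λ x → trans (h↦τ (g ⟨$⟩ʳ x)) (cong (τ ⟨$⟩ʳ_) (g↦σ x)) }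
  ; closed-⁻¹ = λ { σ (g , g∈G , g↦σ) → flip g , closed-⁻¹ g g∈G , λ x → begin
      cls (g ⟨$⟩ˡ x)                         ≡⟨ Perm.inverseˡ σ ⟨
      σ ⟨$⟩ˡ (σ ⟨$⟩ʳ cls (g ⟨$⟩ˡ x))         ≡⟨ cong (σ ⟨$⟩ˡ_) (g↦σ _) ⟨
      σ ⟨$⟩ˡ cls (g ⟨$⟩ʳ (g ⟨$⟩ˡ x))         ≡⟨ cong (λ y → σ ⟨$⟩ˡ cls y) (Perm.inverseʳ g) ⟩
      σ ⟨$⟩ˡ cls x                           ∎ }
  }
  where
  open IsPermGroup isPermGroup
  open ≡-Reasoning

m≤n⇒m∣n! : ∀ {m n} → 0 < m → m ≤ n → m ∣ n !
m≤n⇒m∣n! {suc m} _ m≤n = ∣-trans (m∣m*n (m !)) (m≤n⇒m!∣n! m≤n)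

-- By pigeonhole each point returns after some 0 < t ≤ n steps, and every such t divides n!.
injective⇒periodic-factorial : ∀ {n} (f : Fin n → Fin n) → Injective _≡_ _≡_ f → Periodic (n !) f
injective⇒periodic-factorial {n} f f-inj x with pigeonhole (n<1+n n) (λ i → (f ^ᶠ toℕ i) x)
... | i , j , i<j , fⁱx≡fʲx with m≤n⇒m∣n! (m<n⇒0<n∸m i<j) (≤-trans (m∸n≤m (toℕ j) (toℕ i)) (s≤s⁻¹ (toℕ<n j)))
...   | divides c n!≡c*t = trans (cong (λ s → (f ^ᶠ s) x) n!≡c*t) (^ᶠ-periodic f returns c)
  where
  returns : (f ^ᶠ (toℕ j ∸ toℕ i)) x ≡ x
  returns = ^ᶠ-injective f-inj (toℕ i) (begin
    (f ^ᶠ toℕ i) ((f ^ᶠ (toℕ j ∸ toℕ i)) x)   ≡⟨ ^ᶠ-+ f (toℕ i) _ x ⟨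
    (f ^ᶠ (toℕ i + (toℕ j ∸ toℕ i))) x        ≡⟨ cong (λ s → (f ^ᶠ s) x) (m+[n∸m]≡n (<⇒≤ i<j)) ⟩
    (f ^ᶠ toℕ j) x                            ≡⟨ fⁱx≡fʲx ⟨
    (f ^ᶠ toℕ i) x                            ∎)
    where open ≡-Reasoning

prime-power-factorisation : ∀ {p} → Prime p → ∀ N → 0 < N → ∃₂ λ a m → N ≡ p ^ a * m × ¬ p ∣ m
prime-power-factorisation {p} pp = <-rec _ step
  where
  step : ∀ N → (∀ {M} → M < N → 0 < M → ∃₂ λ a m → M ≡ p ^ a * m × ¬ p ∣ m) →
         0 < N → ∃₂ λ a m → N ≡ p ^ a * m × ¬ p ∣ m
  step N rec 0<N with p ∣? N
  ... | no p∤N = 0 , N , sym (*-identityˡ N) , p∤N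
  ... | yes (divides q N≡q*p) with rec q<N 0<q
    where
    0<q : 0 < q
    0<q = n≢0⇒n>0 λ { refl → <⇒≢ 0<N (sym N≡q*p) }
    q<N : q < N
    q<N = subst (q <_) (sym N≡q*p) (m<m*n q p {{>-nonZero 0<q}} (nonTrivial⇒n>1 p {{prime⇒nonTrivial pp}}))
  ... | a , m , q≡pᵃm , p∤m = suc a , m , (begin
    N                 ≡⟨ N≡q*p ⟩
    q * p             ≡⟨ cong (_* p) q≡pᵃm ⟩
    p ^ a * m * p     ≡⟨ *-assoc (p ^ a) m p ⟩
    p ^ a * (m * p)   ≡⟨ cong (p ^ a *_) (*-comm m p) ⟩
    p ^ a * (p * m)   ≡⟨ *-assoc (p ^ a) p m ⟨
    p ^ a * p * m     ≡⟨ cong (_* m) (*-comm (p ^ a) p) ⟩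
    p ^ suc a * m     ∎) , p∤m
    where open ≡-Reasoning

-- Writing b! = pᵃ m with p ∤ m, the map fᵐ has p-power order; its fixed points number b modulo p.
power-with-fixed-point : ∀ {b p} → Prime p → ¬ p ∣ b → (f : Fin b → Fin b) → Injective _≡_ _≡_ f →
                         ∃₂ λ m j → ¬ p ∣ m × (f ^ᶠ m) j ≡ j
power-with-fixed-point {b} {p} pp p∤b f f-inj
  with prime-power-factorisation pp (b !) (1≤n! b)
... | a , m , b!≡pᵃm , p∤m
  with countIn-fixed-mod-prime-power pp a (f ^ᶠ m) fᵐ-periodic
  where
  open Enumeration (allFin-isEnumeration b) using (countIn-fixed-mod-prime-power)
  fᵐ-periodic : Periodic (p ^ a) (f ^ᶠ m)
  fᵐ-periodic x = begin
    ((f ^ᶠ m) ^ᶠ (p ^ a)) x    ≡⟨ ^ᶠ-* f (p ^ a) m x ⟨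
    (f ^ᶠ (p ^ a * m)) x       ≡⟨ cong (λ s → (f ^ᶠ s) x) b!≡pᵃm ⟨
    (f ^ᶠ (b !)) x             ≡⟨ injective⇒periodic-factorial f f-inj x ⟩
    x                          ∎
    where open ≡-Reasoning
... | q , b≡fixed+pq = m , proj₁ fixed-point , p∤m , proj₂ fixed-point
  where
  open Enumeration (allFin-isEnumeration b) using (fixed?)
  fixed-point = countIn≢0⇒∃ (fixed? (f ^ᶠ m)) (allFin b) λ none →
    p∤b (divides q (begin
      b                                           ≡⟨ length-allFin b ⟨
      length (allFin b)                           ≡⟨ b≡fixed+pq ⟩
      countIn (fixed? (f ^ᶠ m)) (allFin b) + p * q ≡⟨ cong (_+ p * q) none ⟩
      p * q                                       ≡⟨ *-comm p q ⟩
      q * p                                       ∎))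
    where open ≡-Reasoning

≡r+p*q∧m<p⇒m≡r : ∀ {m r p q} → m ≡ r + p * q → m < p → m ≡ r
≡r+p*q∧m<p⇒m≡r {r = r} {p} {zero} m≡r+p*0 _ = trans m≡r+p*0 (trans (cong (r +_) (*-zeroʳ p)) (+-identityʳ r))
≡r+p*q∧m<p⇒m≡r {r = r} {p} {suc q} m≡ m<p =
  contradiction (≤-trans (m≤m*n p (suc q)) (≤-trans (m≤n+m _ r) (≤-reflexive (sym m≡)))) (<⇒≱ m<p)

≡r+p*q∧r<m⇒r≤m∸p : ∀ {m r p q} → m ≡ r + p * q → r < m → r ≤ m ∸ p
≡r+p*q∧r<m⇒r≤m∸p {r = r} {p} {zero} m≡ r<m =
  contradiction (trans m≡ (trans (cong (r +_) (*-zeroʳ p)) (+-identityʳ r))) (≢-sym (<⇒≢ r<m))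
≡r+p*q∧r<m⇒r≤m∸p {r = r} {p} {suc q} m≡ _ =
  m+n≤o⇒m≤o∸n r (≤-trans (+-monoʳ-≤ r (m≤m*n p (suc q))) (≤-reflexive (sym m≡)))

module _ {d p : ℕ} (pp : Prime p) (τ : Fin d → Fin d) (τ-periodic : Periodic p τ) where

  open Enumeration (allFin-isEnumeration d) using (fixed?; module Orbits)
  open Orbits pp τ using (countIn-fixed-mod)

  -- Orbits of τ have size 1 or p: a non-trivial τ fixes at most d − p points, and a
  -- τ-invariant set with fewer than p points consists of fixed points.
  small-invariant-set-bound : (∃ λ δ → τ δ ≢ δ) → {S : Pred (Fin d) 0ℓ} (S? : Decidable S) →
                              (∀ {δ} → S δ → S (τ δ)) → count S? < p → count S? ≤ d ∸ p
  small-invariant-set-bound (δ₀ , τδ₀≢δ₀) S? S-closed |S|<p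
    with countIn-fixed-mod S? S-closed (λ _ → τ-periodic _) | countIn-fixed-mod U? (λ _ → _) (λ _ → τ-periodic _)
  ... | _ , |S|≡ | q , |U|≡ = begin
    count S?                     ≡⟨ ≡r+p*q∧m<p⇒m≡r {p = p} |S|≡ |S|<p ⟩
    count (S? ∩? fixed? τ)       ≤⟨ countIn-mono _ (fixed? τ) proj₂ (allFin d) ⟩
    count (fixed? τ)             ≤⟨ ≡r+p*q∧r<m⇒r≤m∸p {p = p} d≡fixed+pq fixed<d ⟩
    d ∸ p                        ∎
    where
    open ≤-Reasoning
    d≡fixed+pq : d ≡ count (fixed? τ) + p * q
    d≡fixed+pq = begin-equality
      d                               ≡⟨ length-allFin d ⟨
      length (allFin d)               ≡⟨ countIn-universal U? _ (allFin d) ⟨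
      count {d} U?                    ≡⟨ |U|≡ ⟩
      count (U? ∩? fixed? τ) + p * q  ≡⟨ cong (_+ p * q) (countIn-≐ _ (fixed? τ) (proj₂ , (_ ,_)) (allFin d)) ⟩
      count (fixed? τ) + p * q        ∎
    fixed<d : count (fixed? τ) < d
    fixed<d = subst (count (fixed? τ) <_) (length-allFin d)
                    (filter-notAll (fixed? τ) (allFin d) (lose (∈-allFin δ₀) τδ₀≢δ₀))

-- Blocks and classes

module _ {v b d : ℕ} (B : Fin b → Subset v) (cls : Fin v → Fin d) where

  meets? : ∀ i → Decidable (λ δ → meet B cls i δ ≢ 0)
  meets? i δ = ¬? (meet B cls i δ ≟ℕ 0)

  block-size-by-classes : ∀ i {ℓ} → (∀ δ → meet B cls i δ ≢ 0 → meet B cls i δ ≡ ℓ) →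
                          ∣ B i ∣ ≡ count (meets? i) * ℓ
  block-size-by-classes i {ℓ} uniform = begin
    ∣ B i ∣                                 ≡⟨ ∣s∣≡count-∈ (B i) ⟩
    count (_∈? B i)                         ≡⟨ countIn-fibres (_∈? B i) cls (allFin v) ⟩
    sum (map (meet B cls i) (allFin d))     ≡⟨ sum-map-indicator (meets? i) (meet B cls i) ℓ (uniform _)
                                                 (decidable-stable (meet B cls i _ ≟ℕ 0)) (allFin d) ⟩
    count (meets? i) * ℓ                    ∎
    where open ≡-Reasoning

module BlockAction {v b : ℕ} {B : Fin b → Subset v} {g : Permutation′ v}
                   (blocks-distinct : ∀ i j → B i ≡ B j → i ≡ j) (g-aut : IsAut B g) where

  act : Fin b → Fin b
  act i = proj₁ (g-aut i)

  private
    maps : ∀ i y → (y ∈ B i) → (g ⟨$⟩ʳ y) ∈ B (act i)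
    maps i y = Equivalence.to (proj₂ (g-aut i) y)
    maps⁻¹ : ∀ i y → (g ⟨$⟩ʳ y) ∈ B (act i) → y ∈ B i
    maps⁻¹ i y = Equivalence.from (proj₂ (g-aut i) y)

  act-injective : Injective _≡_ _≡_ act
  act-injective {i} {i′} act-i≡act-i′ = blocks-distinct i i′ (⊆-antisym
    (λ {y} y∈Bi → maps⁻¹ i′ y (subst (λ j → g ⟨$⟩ʳ y ∈ B j) act-i≡act-i′ (maps i y y∈Bi)))
    (λ {y} y∈Bi′ → maps⁻¹ i y (subst (λ j → g ⟨$⟩ʳ y ∈ B j) (sym act-i≡act-i′) (maps i′ y y∈Bi′))))

  act-^ᶠ : ∀ t {i y} → y ∈ B i → ((g ⟨$⟩ʳ_) ^ᶠ t) y ∈ B ((act ^ᶠ t) i)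
  act-^ᶠ zero y∈Bi = y∈Bi
  act-^ᶠ (suc t) y∈Bi = maps _ _ (act-^ᶠ t y∈Bi)

  classes-met-invariant : ∀ {d} (cls : Fin v → Fin d) {σ : Fin d → Fin d} → (∀ x → cls (g ⟨$⟩ʳ x) ≡ σ (cls x)) →
                          ∀ m {j} → (act ^ᶠ m) j ≡ j →
                          ∀ {δ} → meet B cls j δ ≢ 0 → meet B cls j ((σ ^ᶠ m) δ) ≢ 0
  classes-met-invariant {d} cls {σ} g↦σ m {j} j-fixed {δ} meets with countIn≢0⇒∃ _ (allFin v) meets
  ... | y , y∈Bj , cls-y≡δ = λ none → contradiction (subst (1 ≤_) none (countIn-pos _ (image∈Bj , cls-image))) (λ ())
    where
    open Enumeration (allFin-isEnumeration v) using (countIn-pos)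
    image∈Bj : ((g ⟨$⟩ʳ_) ^ᶠ m) y ∈ B j
    image∈Bj = subst (λ i → ((g ⟨$⟩ʳ_) ^ᶠ m) y ∈ B i) j-fixed (act-^ᶠ m y∈Bj)
    cls-image : cls (((g ⟨$⟩ʳ_) ^ᶠ m) y) ≡ (σ ^ᶠ m) δ
    cls-image = trans (^ᶠ-natural cls g↦σ m y) (cong (σ ^ᶠ m) cls-y≡δ)

proposition2p2 :
    (v k λ' b : ℕ) (B : Fin b → Subset v) → Is2Design v k λ' b B →
    (G : Permutation′ v → Set) → IsPermGroup G →
    (∀ g → G g → IsAut B g) → FlagTransitive B G →
    (d c : ℕ) → 2 ≤ d → 2 ≤ c → (cls : Fin v → Fin d) →
    IsUniformPartition d c cls → PreservesPartition cls G →
    (ℓ : ℕ) → 2 ≤ ℓ → (∀ i δ → meet B cls i δ ≢ 0 → meet B cls i δ ≡ ℓ) →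
    (p : ℕ) → Prime p →
    p ≤ d → (d ∸ p) * ℓ < k → k < p * ℓ →
    ¬ (p ∣ b) →
    (n : ℕ) → HasOrder (Induced cls G) n → ¬ (p ∣ n)
proposition2p2 v k _ b B design G isPermGroup aut _ d _ _ _ cls _ _ ℓ _ uniform-meet p pp _ lower upper p∤b n order p∣n
  with element-of-prime-order pp p∣n
  where open FinitePermutationGroup (induced-isPermGroup {cls = cls} isPermGroup) order
... | σ , (g , g∈G , g↦σ) , σ-periodic , δ₀ , σδ₀≢δ₀
  with power-with-fixed-point pp p∤b act act-injective
  where open BlockAction {B = B} {g = g} (Is2Design.blocks-distinct design) (aut g g∈G)
... | m , j , p∤m , j-fixed = <⇒≱ lower (subst (_≤ (d ∸ p) * ℓ) (sym k≡|S|ℓ) (*-monoˡ-≤ ℓ |S|≤d∸p))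
  where
  open Is2Design design
  open BlockAction {B = B} {g = g} blocks-distinct (aut g g∈G)
  τ = (σ ⟨$⟩ʳ_) ^ᶠ m
  meets-j? = meets? B cls j
  k≡|S|ℓ : k ≡ count meets-j? * ℓ
  k≡|S|ℓ = trans (sym (block-size j)) (block-size-by-classes B cls j (uniform-meet j))
  τδ₀≢δ₀ : τ δ₀ ≢ δ₀
  τδ₀≢δ₀ τδ₀≡δ₀ = σδ₀≢δ₀ (prime-period⇒fixed (σ ⟨$⟩ʳ_) pp p∤m (σ-periodic δ₀) τδ₀≡δ₀)
  |S|<p : count meets-j? < p
  |S|<p = *-cancelʳ-< ℓ _ _ (subst (_< p * ℓ) k≡|S|ℓ upper)
  |S|≤d∸p : count meets-j? ≤ d ∸ p
  |S|≤d∸p = small-invariant-set-bound pp τ (^ᶠ-periodic-power {p = p} σ-periodic m) (δ₀ , τδ₀≢δ₀) meets-j?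
              (classes-met-invariant cls g↦σ m j-fixed) |S|<p
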